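{- For each $n\ge0$, the statistics $(S,R)\mapsto \mathrm{max}(S)$ and $(S,R)\mapsto\mathrm{max}(R)$ have symmetric joint distribution on the set of isomorphism types of Catalan pairs of type 1 on $n$ elements; that is, for all $k,\ell$, the number of such pairs with $\mathrm{max}(S)=k$, $\mathrm{max}(R)=\ell$ equals the number with $\mathrm{max}(S)=\ell$, $\mathrm{max}(R)=k$.
   Context: For a relation $R$ on $X$, $x$ is $R$-maximal if there is no $y$ with $xRy$; $\mathrm{max}(R)$ is the number of $R$-maximal elements. A Catalan pair of type 1 is a pair $(S,R)$ of relations on a finite set $X$ with: $S$ and $R$ partial orders (irreflexive, transitive); any two distinct elements comparable ($xRy$ or $yRx$, resp. for $S$) by exactly one of $S$, $R$; for distinct $x,y,z$ with $xSy$ and $yRz$ we have $xRz$. Pairs are considered up to isomorphism (bijections of ground sets preserving both relations). -}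

module Defs where

open import Data.Nat using (ℕ)
open import Data.Bool using (Bool; true; false; not; _∨_; _xor_)
open import Data.Fin using (Fin)
open import Data.Fin.Permutation using (Permutation′; _⟨$⟩ʳ_)
open import Data.List using (List; length; filterᵇ; allFin)
open import Data.Bool.ListAction using (all)
open import Data.Product using (Σ; _×_)
open import Relation.Binary.PropositionalEquality using (_≡_; _≢_)

Rel₂ : ℕ → Set
Rel₂ n = Fin n → Fin n → Bool

IsStrictPartialOrder : ∀ {n} → Rel₂ n → Set
IsStrictPartialOrder {n} R =
  (∀ (x : Fin n) → R x x ≡ false) ×
  (∀ (x y z : Fin n) → R x y ≡ true → R y z ≡ true → R x z ≡ true)

record CatalanPair (n : ℕ) : Set where
  field
    S R       : Rel₂ n
    S-po      : IsStrictPartialOrder S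
    R-po      : IsStrictPartialOrder R
    exactlyOne : ∀ (x y : Fin n) → x ≢ y →
                 ((S x y ∨ S y x) xor (R x y ∨ R y x)) ≡ true
    compat    : ∀ (x y z : Fin n) → x ≢ y → y ≢ z → x ≢ z →
                S x y ≡ true → R y z ≡ true → R x z ≡ true

open CatalanPair public

maxCount : ∀ {n} → Rel₂ n → ℕ
maxCount {n} R = length (filterᵇ (λ x → all (λ y → not (R x y)) (allFin n)) (allFin n))

maxS maxR : ∀ {n} → CatalanPair n → ℕ
maxS p = maxCount (S p)
maxR p = maxCount (R p)

_≅_ : ∀ {n} → CatalanPair n → CatalanPair n → Set
_≅_ {n} p q = Σ (Permutation′ n) λ σ →
  (∀ (x y : Fin n) → S p x y ≡ S q (σ ⟨$⟩ʳ x) (σ ⟨$⟩ʳ y)) ×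
  (∀ (x y : Fin n) → R p x y ≡ R q (σ ⟨$⟩ʳ x) (σ ⟨$⟩ʳ y))

PairsWith : ℕ → ℕ → ℕ → Set
PairsWith n k l = Σ (CatalanPair n) λ p → (maxS p ≡ k) × (maxR p ≡ l)

_≅ʷ_ : ∀ {n k l} → PairsWith n k l → PairsWith n k l → Set
a ≅ʷ b = Data.Product.proj₁ a ≅ Data.Product.proj₁ b

-- The isomorphism types in PairsWith n k l and in PairsWith n k' l' are
-- equinumerous: a bijection between the quotients by ≅, given by
-- ≅-respecting maps inverse to each other up to ≅.
SameNumberOfIsoTypes : ∀ {n k l k' l'} → Set
SameNumberOfIsoTypes {n} {k} {l} {k'} {l'} =
  Σ (PairsWith n k l → PairsWith n k' l') λ f →
  Σ (PairsWith n k' l' → PairsWith n k l) λ g →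
    (∀ a b → a ≅ʷ b → f a ≅ʷ f b) ×
    (∀ a b → a ≅ʷ b → g a ≅ʷ g b) ×
    (∀ a → g (f a) ≅ʷ a) ×
    (∀ b → f (g b) ≅ʷ b)

-- Write ↑x for the set of S-successors of x. The map φ with (φ≺ and φ◁ below, ≺ standing for S
-- and ◁ for R)
--   x S′ y  iff  x R y and ↑y ⊆ ↑x,
--   x R′ y  iff  x S y, or y R x and ↑x ⊈ ↑y
-- sends Catalan pairs to Catalan pairs, commutes with isomorphism and is an involution,
-- so it is a bijection on isomorphism types; it exchanges the two statistics.
-- An element is R′-maximal iff it is S-maximal, since ↑x = ∅ forces ↑x ⊆ ↑y.
-- It is S′-maximal iff it is R-maximal: walking up along S from an R-successor y of x,
-- always to an S-successor of the current element that is not in ↑x, stays among the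
-- R-successors of x and must stop (S is well founded on a finite set) at some z with ↑z ⊆ ↑x.

module Submission where

open import Defs
open import Data.Nat using (ℕ)
open import Data.Bool using (true; false; not; _∨_; _xor_; T)
import Data.Bool.Properties as Bool
open import Data.Bool.ListAction using (all)
open import Data.Fin using (Fin)
import Data.Fin.Properties as Fin
open import Data.Fin.Induction using (spo-noetherian)
open import Data.Fin.Permutation using (Permutation′; _⟨$⟩ʳ_; _⟨$⟩ˡ_; inverseʳ; id)
open import Data.List using (length; allFin)
open import Data.List.Properties using (filter-≐)
open import Data.List.Relation.Unary.All.Properties using (all⁺; all⁻; tabulate⁺; tabulate⁻)
open import Data.Product using (∃-syntax; _×_; _,_; proj₁; proj₂; uncurry)
open import Data.Product.Function.NonDependent.Propositional using (_×-⇔_)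
open import Data.Sum as Sum using (_⊎_; inj₁; inj₂; [_,_])
open import Data.Sum.Function.Propositional using (_⊎-⇔_)
open import Data.Empty using (⊥)
open import Function using (_∘_; flip; _⇔_; mk⇔; Equivalence)
open import Function.Related.TypeIsomorphisms using (¬-cong-⇔)
import Function.Properties.Equivalence as ⇔
open import Induction.WellFounded using (Acc; acc)
open import Level using (0ℓ)
open import Relation.Binary.Core using (Rel)
open import Relation.Binary.Definitions using (Decidable; Transitive)
import Relation.Binary.Structures as B
open import Relation.Binary.PropositionalEquality using (_≡_; _≢_; refl; sym; trans; cong; isEquivalence; resp₂)
open import Relation.Nullary using (¬_; Dec; yes; no; does; ¬?; _×-dec_; _⊎-dec_; _→-dec_)
open import Relation.Nullary.Decidable using (dec-true; dec-false; does-⇔; decidable-stable)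
open import Relation.Nullary.Negation using (contradiction)

open Equivalence using (to; from)

∨≡true⇔ : ∀ {a b} → a ∨ b ≡ true ⇔ (a ≡ true ⊎ b ≡ true)
∨≡true⇔ {true}  = mk⇔ inj₁ (λ _ → refl)
∨≡true⇔ {false} = mk⇔ inj₂ [ (λ ()) , (λ b≡true → b≡true) ]

xor≡true⇒ : ∀ {a b} → a xor b ≡ true → (a ≡ true ⊎ b ≡ true) × ¬ (a ≡ true × b ≡ true)
xor≡true⇒ {true}  {false} _ = inj₁ refl , λ { (_ , ()) }
xor≡true⇒ {false} {true}  _ = inj₂ refl , λ { (() , _) }

does≡true⇔ : ∀ {A : Set} (a? : Dec A) → does a? ≡ true ⇔ A
does≡true⇔ (yes a) = mk⇔ (λ _ → a) (λ _ → refl)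
does≡true⇔ (no ¬a) = mk⇔ (λ ()) (λ a → contradiction a ¬a)

does-xor : ∀ {A B : Set} (a? : Dec A) (b? : Dec B) → A ⊎ B → ¬ (A × B) →
           does a? xor does b? ≡ true
does-xor (yes a) (yes b) _   ¬ab = contradiction (a , b) ¬ab
does-xor (yes _) (no _)  _   _   = refl
does-xor (no _)  (yes _) _   _   = refl
does-xor (no ¬a) (no ¬b) a⊎b _   = contradiction a⊎b [ ¬a , ¬b ]

Comparable : ∀ {A : Set} → Rel A 0ℓ → Rel A 0ℓ
Comparable _<_ x y = x < y ⊎ y < x

Maximal : ∀ {A : Set} → Rel A 0ℓ → A → Set
Maximal _<_ x = ∀ y → ¬ x < y

Maximal-cong : ∀ {A : Set} {P Q : Rel A 0ℓ} → (∀ x y → P x y ⇔ Q x y) →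
               ∀ x → Maximal P x ⇔ Maximal Q x
Maximal-cong P⇔Q x = mk⇔ (λ max y → max y ∘ from (P⇔Q x y)) (λ max y → max y ∘ to (P⇔Q x y))

≡-isStrictPartialOrder : ∀ {A : Set} {_<_ : Rel A 0ℓ} →
                         (∀ {x} → ¬ x < x) → Transitive _<_ → B.IsStrictPartialOrder _≡_ _<_
≡-isStrictPartialOrder {_<_ = _<_} <-irrefl <-trans = record
  { isEquivalence = isEquivalence
  ; irrefl        = λ { refl → <-irrefl }
  ; trans         = <-trans
  ; <-resp-≈      = resp₂ _<_
  }

-- Unlike compat in CatalanPair, compatible needs no distinctness hypotheses: they follow
-- from the other axioms.
record IsCatalanPair {A : Set} (_≺_ _◁_ : Rel A 0ℓ) : Set where
  field
    ≺-isStrictPartialOrder : B.IsStrictPartialOrder _≡_ _≺_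
    ◁-isStrictPartialOrder : B.IsStrictPartialOrder _≡_ _◁_
    comparable : ∀ {x y} → x ≢ y → Comparable _≺_ x y ⊎ Comparable _◁_ x y
    exclusive  : ∀ {x y} → Comparable _≺_ x y → Comparable _◁_ x y → ⊥
    compatible : ∀ {x y z} → x ≺ y → y ◁ z → x ◁ z

  private
    module ≺ = B.IsStrictPartialOrder ≺-isStrictPartialOrder
    module ◁ = B.IsStrictPartialOrder ◁-isStrictPartialOrder

  ≺-irrefl : ∀ {x} → ¬ x ≺ x
  ≺-irrefl = ≺.irrefl refl

  ◁-irrefl : ∀ {x} → ¬ x ◁ x
  ◁-irrefl = ◁.irrefl refl

  ≺-trans : Transitive _≺_
  ≺-trans = ≺.trans

  ◁-trans : Transitive _◁_
  ◁-trans = ◁.trans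

  ◁-asym : ∀ {x y} → x ◁ y → ¬ y ◁ x
  ◁-asym = ◁.asym

  ≺⇒¬◁ : ∀ {x y} → x ≺ y → ¬ x ◁ y
  ≺⇒¬◁ x≺y x◁y = exclusive (inj₁ x≺y) (inj₁ x◁y)

  ≺⇒¬◁˘ : ∀ {x y} → x ≺ y → ¬ y ◁ x
  ≺⇒¬◁˘ x≺y y◁x = exclusive (inj₁ x≺y) (inj₂ y◁x)

_⊆↑[_]_ : ∀ {A : Set} → A → Rel A 0ℓ → A → Set
x ⊆↑[ _<_ ] y = ∀ k → x < k → y < k

⊆↑-dec : ∀ {n} {_<_ : Rel (Fin n) 0ℓ} → Decidable _<_ → Decidable (_⊆↑[ _<_ ]_)
⊆↑-dec _<?_ x y = Fin.all? λ k → (x <? k) →-dec (y <? k)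

module _ {A : Set} (_≺_ _◁_ : Rel A 0ℓ) where

  φ≺ φ◁ : Rel A 0ℓ
  φ≺ x y = x ◁ y × y ⊆↑[ _≺_ ] x
  φ◁ x y = x ≺ y ⊎ (y ◁ x × ¬ x ⊆↑[ _≺_ ] y)

module _ {n} {_≺_ _◁_ : Rel (Fin n) 0ℓ} (_≺?_ : Decidable _≺_) (_◁?_ : Decidable _◁_) where

  φ≺-dec : Decidable (φ≺ _≺_ _◁_)
  φ≺-dec x y = (x ◁? y) ×-dec ⊆↑-dec _≺?_ y x

  φ◁-dec : Decidable (φ◁ _≺_ _◁_)
  φ◁-dec x y = (x ≺? y) ⊎-dec ((y ◁? x) ×-dec ¬? (⊆↑-dec _≺?_ x y))

-- A record rather than a function type, so that P, σ and Q can be inferred from it.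
record _⇔[_]_ {n} (P : Rel (Fin n) 0ℓ) (σ : Permutation′ n) (Q : Rel (Fin n) 0ℓ) : Set where
  constructor mk⇔[]
  field
    ⇔-at : ∀ x y → P x y ⇔ Q (σ ⟨$⟩ʳ x) (σ ⟨$⟩ʳ y)

open _⇔[_]_

module _ {n} {σ : Permutation′ n} {_≺₁_ _◁₁_ _≺₂_ _◁₂_ : Rel (Fin n) 0ℓ} where

  ⊆↑-resp : _≺₁_ ⇔[ σ ] _≺₂_ → (_⊆↑[ _≺₁_ ]_) ⇔[ σ ] (_⊆↑[ _≺₂_ ]_)
  ⊆↑-resp ≺₁⇔≺₂ = mk⇔[] λ x y → mk⇔ (forward x y) (backward x y)
    where
    forward : ∀ x y → x ⊆↑[ _≺₁_ ] y → (σ ⟨$⟩ʳ x) ⊆↑[ _≺₂_ ] (σ ⟨$⟩ʳ y)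
    forward x y x⊆↑y k with σ ⟨$⟩ˡ k | inverseʳ σ {k}
    ... | k₀ | refl = to (⇔-at ≺₁⇔≺₂ y k₀) ∘ x⊆↑y k₀ ∘ from (⇔-at ≺₁⇔≺₂ x k₀)

    backward : ∀ x y → (σ ⟨$⟩ʳ x) ⊆↑[ _≺₂_ ] (σ ⟨$⟩ʳ y) → x ⊆↑[ _≺₁_ ] y
    backward x y σx⊆↑σy k = from (⇔-at ≺₁⇔≺₂ y k) ∘ σx⊆↑σy (σ ⟨$⟩ʳ k) ∘ to (⇔-at ≺₁⇔≺₂ x k)

  φ≺-resp : _≺₁_ ⇔[ σ ] _≺₂_ → _◁₁_ ⇔[ σ ] _◁₂_ → φ≺ _≺₁_ _◁₁_ ⇔[ σ ] φ≺ _≺₂_ _◁₂_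
  φ≺-resp ≺₁⇔≺₂ ◁₁⇔◁₂ = mk⇔[] λ x y → ⇔-at ◁₁⇔◁₂ x y ×-⇔ ⇔-at (⊆↑-resp ≺₁⇔≺₂) y x

  φ◁-resp : _≺₁_ ⇔[ σ ] _≺₂_ → _◁₁_ ⇔[ σ ] _◁₂_ → φ◁ _≺₁_ _◁₁_ ⇔[ σ ] φ◁ _≺₂_ _◁₂_
  φ◁-resp ≺₁⇔≺₂ ◁₁⇔◁₂ = mk⇔[] λ x y →
    ⇔-at ≺₁⇔≺₂ x y ⊎-⇔ (⇔-at ◁₁⇔◁₂ y x ×-⇔ ¬-cong-⇔ (⇔-at (⊆↑-resp ≺₁⇔≺₂) x y))

module Involution {n} {_≺_ _◁_ : Rel (Fin n) 0ℓ}
                  (_≺?_ : Decidable _≺_) (isCatalan : IsCatalanPair _≺_ _◁_) where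

  open IsCatalanPair isCatalan

  private
    _⊆↑_ _≺′_ _◁′_ : Rel (Fin n) 0ℓ
    x ⊆↑ y = x ⊆↑[ _≺_ ] y
    _≺′_ = φ≺ _≺_ _◁_
    _◁′_ = φ◁ _≺_ _◁_

  data Compare (x y : Fin n) : Set where
    equal  : x ≡ y → Compare x y
    ≺-to   : x ≺ y → Compare x y
    ≺-from : y ≺ x → Compare x y
    ◁-to   : x ◁ y → Compare x y
    ◁-from : y ◁ x → Compare x y

  compare : ∀ x y → Compare x y
  compare x y with x Fin.≟ y
  ... | yes x≡y = equal x≡y
  ... | no x≢y with comparable x≢y
  ...   | inj₁ (inj₁ x≺y) = ≺-to x≺y
  ...   | inj₁ (inj₂ y≺x) = ≺-from y≺x
  ...   | inj₂ (inj₁ x◁y) = ◁-to x◁y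
  ...   | inj₂ (inj₂ y◁x) = ◁-from y◁x

  ◁-interval : ∀ {a b c k} → a ◁ b → b ◁ c → a ≺ k → c ≺ k → b ≺ k
  ◁-interval {b = b} {k = k} a◁b b◁c a≺k c≺k with compare b k
  ... | equal refl = contradiction a◁b (≺⇒¬◁ a≺k)
  ... | ≺-to b≺k   = b≺k
  ... | ≺-from k≺b = contradiction b◁c (≺⇒¬◁˘ (≺-trans c≺k k≺b))
  ... | ◁-to b◁k   = contradiction (◁-trans a◁b b◁k) (≺⇒¬◁ a≺k)
  ... | ◁-from k◁b = contradiction (compatible c≺k k◁b) (◁-asym b◁c)

  ◁-extend : ∀ {x y k} → x ◁ y → y ≺ k → ¬ x ≺ k → x ◁ k
  ◁-extend {x} {k = k} x◁y y≺k x⊀k with compare x k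
  ... | equal refl = contradiction x◁y (≺⇒¬◁˘ y≺k)
  ... | ≺-to x≺k   = contradiction x≺k x⊀k
  ... | ≺-from k≺x = contradiction x◁y (≺⇒¬◁˘ (≺-trans y≺k k≺x))
  ... | ◁-to x◁k   = x◁k
  ... | ◁-from k◁x = contradiction (compatible y≺k k◁x) (◁-asym x◁y)

  ⊆↑-or-witness : ∀ x y → x ⊆↑ y ⊎ ∃[ k ] (x ≺ k × ¬ y ≺ k)
  ⊆↑-or-witness x y with Fin.any? (λ k → (x ≺? k) ×-dec ¬? (y ≺? k))
  ... | yes witness = inj₂ witness
  ... | no none     = inj₁ λ k x≺k → decidable-stable (y ≺? k) λ y⊀k → none (k , x≺k , y⊀k)

  ◁⇒≺′-above : ∀ {x y} → x ◁ y → ∃[ z ] (x ≺′ z × (y ≡ z ⊎ y ≺ z))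
  ◁⇒≺′-above {x} {y} = go (spo-noetherian ≺-isStrictPartialOrder y)
    where
    go : ∀ {y} → Acc (flip _≺_) y → x ◁ y → ∃[ z ] (x ≺′ z × (y ≡ z ⊎ y ≺ z))
    go {y} (acc above) x◁y with ⊆↑-or-witness y x
    ... | inj₁ y⊆↑x = y , (x◁y , y⊆↑x) , inj₁ refl
    ... | inj₂ (k , y≺k , x⊀k) with go (above y≺k) (◁-extend x◁y y≺k x⊀k)
    ...   | z , x≺′z , inj₁ refl = z , x≺′z , inj₂ y≺k
    ...   | z , x≺′z , inj₂ k≺z  = z , x≺′z , inj₂ (≺-trans y≺k k≺z)

  ≺′-irrefl : ∀ {x} → ¬ x ≺′ x
  ≺′-irrefl (x◁x , _) = ◁-irrefl x◁x

  ≺′-trans : Transitive _≺′_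
  ≺′-trans (x◁y , y⊆↑x) (y◁z , z⊆↑y) = ◁-trans x◁y y◁z , λ k → y⊆↑x k ∘ z⊆↑y k

  ◁′-irrefl : ∀ {x} → ¬ x ◁′ x
  ◁′-irrefl = [ ≺-irrefl , ◁-irrefl ∘ proj₁ ]

  ◁′-by-elimination : ∀ {i l} → i ≢ l → ¬ l ≺ i → ¬ i ◁ l → ¬ i ⊆↑ l → i ◁′ l
  ◁′-by-elimination {i} {l} i≢l l⊀i ¬i◁l i⊈l with compare i l
  ... | equal i≡l  = contradiction i≡l i≢l
  ... | ≺-to i≺l   = inj₁ i≺l
  ... | ≺-from l≺i = contradiction l≺i l⊀i
  ... | ◁-to i◁l   = contradiction i◁l ¬i◁l
  ... | ◁-from l◁i = inj₂ (l◁i , i⊈l)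

  ◁′-trans : Transitive _◁′_
  ◁′-trans (inj₁ i≺j) (inj₁ j≺l) = inj₁ (≺-trans i≺j j≺l)
  ◁′-trans (inj₁ i≺j) (inj₂ (l◁j , j⊈l)) = ◁′-by-elimination
    (λ { refl → ≺⇒¬◁ i≺j l◁j })
    (λ l≺i → ≺⇒¬◁ (≺-trans l≺i i≺j) l◁j)
    (λ i◁l → ≺⇒¬◁ i≺j (◁-trans i◁l l◁j))
    (λ i⊆↑l → j⊈l λ k j≺k → i⊆↑l k (≺-trans i≺j j≺k))
  ◁′-trans (inj₂ (j◁i , i⊈j)) (inj₁ j≺l) = ◁′-by-elimination
    (λ { refl → ≺⇒¬◁ j≺l j◁i })
    (λ l≺i → ≺⇒¬◁ (≺-trans j≺l l≺i) j◁i)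
    (λ i◁l → ≺⇒¬◁ j≺l (◁-trans j◁i i◁l))
    (λ i⊆↑l → i⊈j λ k i≺k → ≺-trans j≺l (i⊆↑l k i≺k))
  ◁′-trans (inj₂ (j◁i , i⊈j)) (inj₂ (l◁j , j⊈l)) =
    inj₂ (◁-trans l◁j j◁i , λ i⊆↑l → i⊈j λ k i≺k → ◁-interval l◁j j◁i (i⊆↑l k i≺k) i≺k)

  ◁′-compatible : ∀ {x y z} → x ≺′ y → y ◁′ z → x ◁′ z
  ◁′-compatible (x◁y , y⊆↑x) (inj₁ y≺z) = inj₁ (y⊆↑x _ y≺z)
  ◁′-compatible (x◁y , y⊆↑x) (inj₂ (z◁y , y⊈z)) = ◁′-by-elimination
    (λ { refl → y⊈z y⊆↑x })
    (λ z≺x → y⊈z λ k y≺k → ≺-trans z≺x (y⊆↑x k y≺k))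
    (λ x◁z → y⊈z λ k y≺k → ◁-interval x◁z z◁y (y⊆↑x k y≺k) y≺k)
    (λ x⊆↑z → y⊈z λ k → x⊆↑z k ∘ y⊆↑x k)

  ≺′⇒¬◁′ : ∀ {x y} → x ≺′ y → ¬ x ◁′ y
  ≺′⇒¬◁′ (x◁y , _) = [ (λ x≺y → ≺⇒¬◁ x≺y x◁y) , (λ (y◁x , _) → ◁-asym x◁y y◁x) ]

  ≺′⇒¬◁′˘ : ∀ {x y} → x ≺′ y → ¬ y ◁′ x
  ≺′⇒¬◁′˘ (x◁y , y⊆↑x) = [ (λ y≺x → ≺⇒¬◁˘ y≺x x◁y) , (λ (_ , y⊈x) → y⊈x y⊆↑x) ]

  ◁⇒comparable′ : ∀ {x y} → x ◁ y → Comparable _≺′_ x y ⊎ Comparable _◁′_ x y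
  ◁⇒comparable′ {x} {y} x◁y with ⊆↑-dec _≺?_ y x
  ... | yes y⊆↑x = inj₁ (inj₁ (x◁y , y⊆↑x))
  ... | no y⊈x   = inj₂ (inj₂ (inj₂ (x◁y , y⊈x)))

  φ-isCatalanPair : IsCatalanPair _≺′_ _◁′_
  φ-isCatalanPair = record
    { ≺-isStrictPartialOrder = ≡-isStrictPartialOrder ≺′-irrefl ≺′-trans
    ; ◁-isStrictPartialOrder = ≡-isStrictPartialOrder ◁′-irrefl ◁′-trans
    ; comparable = comparable′
    ; exclusive  = exclusive′
    ; compatible = ◁′-compatible
    }
    where
    comparable′ : ∀ {x y} → x ≢ y → Comparable _≺′_ x y ⊎ Comparable _◁′_ x y
    comparable′ x≢y with comparable x≢y
    ... | inj₁ (inj₁ x≺y) = inj₂ (inj₁ (inj₁ x≺y))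
    ... | inj₁ (inj₂ y≺x) = inj₂ (inj₂ (inj₁ y≺x))
    ... | inj₂ (inj₁ x◁y) = ◁⇒comparable′ x◁y
    ... | inj₂ (inj₂ y◁x) = Sum.map Sum.swap Sum.swap (◁⇒comparable′ y◁x)

    exclusive′ : ∀ {x y} → Comparable _≺′_ x y → Comparable _◁′_ x y → ⊥
    exclusive′ (inj₁ x≺′y) = [ ≺′⇒¬◁′ x≺′y , ≺′⇒¬◁′˘ x≺′y ]
    exclusive′ (inj₂ y≺′x) = [ ≺′⇒¬◁′˘ y≺′x , ≺′⇒¬◁′ y≺′x ]

  maximal-φ≺⇔ : ∀ x → Maximal _≺′_ x ⇔ Maximal _◁_ x
  maximal-φ≺⇔ x = mk⇔
    (λ max y x◁y → let z , x≺′z , _ = ◁⇒≺′-above x◁y in max z x≺′z)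
    (λ max y → max y ∘ proj₁)

  maximal-φ◁⇔ : ∀ x → Maximal _◁′_ x ⇔ Maximal _≺_ x
  maximal-φ◁⇔ x = mk⇔ (λ max y → max y ∘ inj₁) backward
    where
    backward : Maximal _≺_ x → Maximal _◁′_ x
    backward max y (inj₁ x≺y)       = max y x≺y
    backward max y (inj₂ (_ , x⊈y)) = x⊈y λ k x≺k → contradiction x≺k (max k)

  ≺⇒⊆↑′ : ∀ {x y} → x ≺ y → y ⊆↑[ _≺′_ ] x
  ≺⇒⊆↑′ x≺y k (y◁k , k⊆↑y) = compatible x≺y y◁k , λ m k≺m → ≺-trans x≺y (k⊆↑y m k≺m)

  ◁⇒⊈↑′ : ∀ {x y} → x ◁ y → ¬ x ⊆↑[ _≺′_ ] y
  ◁⇒⊈↑′ x◁y x⊆↑′y with ◁⇒≺′-above x◁y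
  ... | z , x≺′z , inj₁ refl = ◁-irrefl (proj₁ (x⊆↑′y z x≺′z))
  ... | z , x≺′z , inj₂ y≺z  = ≺⇒¬◁ y≺z (proj₁ (x⊆↑′y z x≺′z))

  φ≺-involutive : ∀ x y → φ≺ _≺′_ _◁′_ x y ⇔ x ≺ y
  φ≺-involutive x y = mk⇔ forward (λ x≺y → inj₁ x≺y , ≺⇒⊆↑′ x≺y)
    where
    forward : φ≺ _≺′_ _◁′_ x y → x ≺ y
    forward (inj₁ x≺y , _)         = x≺y
    forward (inj₂ (y◁x , _) , y⊆↑′x) = contradiction y⊆↑′x (◁⇒⊈↑′ y◁x)

  φ◁-involutive : ∀ x y → φ◁ _≺′_ _◁′_ x y ⇔ x ◁ y
  φ◁-involutive x y = mk⇔ forward backward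
    where
    forward : φ◁ _≺′_ _◁′_ x y → x ◁ y
    forward (inj₁ (x◁y , _))             = x◁y
    forward (inj₂ (inj₁ y≺x , x⊈↑′y))     = contradiction (≺⇒⊆↑′ y≺x) x⊈↑′y
    forward (inj₂ (inj₂ (x◁y , _) , _))  = x◁y

    backward : x ◁ y → φ◁ _≺′_ _◁′_ x y
    backward x◁y with ⊆↑-dec _≺?_ y x
    ... | yes y⊆↑x = inj₁ (x◁y , y⊆↑x)
    ... | no y⊈x   = inj₂ (inj₂ (x◁y , y⊈x) , ◁⇒⊈↑′ x◁y)

⟦_⟧ : ∀ {n} → Rel₂ n → Rel (Fin n) 0ℓ
⟦ r ⟧ x y = r x y ≡ true

⟦⟧-dec : ∀ {n} (r : Rel₂ n) → Decidable ⟦ r ⟧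
⟦⟧-dec r x y = r x y Bool.≟ true

⟦⟧-resp : ∀ {n} {σ : Permutation′ n} {r r′ : Rel₂ n} →
          (∀ x y → r x y ≡ r′ (σ ⟨$⟩ʳ x) (σ ⟨$⟩ʳ y)) → ⟦ r ⟧ ⇔[ σ ] ⟦ r′ ⟧
⟦⟧-resp r≡r′ = mk⇔[] λ x y → mk⇔ (trans (sym (r≡r′ x y))) (trans (r≡r′ x y))

⟦⟧-isStrictPartialOrder : ∀ {n} {r : Rel₂ n} →
                          IsStrictPartialOrder r → B.IsStrictPartialOrder _≡_ ⟦ r ⟧
⟦⟧-isStrictPartialOrder (irrefl , trans) =
  ≡-isStrictPartialOrder (Bool.not-¬ (irrefl _)) (trans _ _ _)

does-isStrictPartialOrder : ∀ {n} {_<_ : Rel (Fin n) 0ℓ} (_<?_ : Decidable _<_) →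
                            B.IsStrictPartialOrder _≡_ _<_ → IsStrictPartialOrder (λ x y → does (x <? y))
does-isStrictPartialOrder _<?_ spo =
    (λ x → dec-false (x <? x) (<.irrefl refl))
  , (λ x y z x<y y<z →
       dec-true (x <? z) (<.trans (to (does≡true⇔ (x <? y)) x<y) (to (does≡true⇔ (y <? z)) y<z)))
  where module < = B.IsStrictPartialOrder spo

isCatalanPair : ∀ {n} (p : CatalanPair n) → IsCatalanPair ⟦ S p ⟧ ⟦ R p ⟧
isCatalanPair p = record
  { ≺-isStrictPartialOrder = ⟦⟧-isStrictPartialOrder (S-po p)
  ; ◁-isStrictPartialOrder = ⟦⟧-isStrictPartialOrder (R-po p)
  ; comparable = comparable
  ; exclusive  = exclusive
  ; compatible = compatible
  }
  where
  S-irrefl : ∀ {x} → ¬ ⟦ S p ⟧ x x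
  S-irrefl = Bool.not-¬ (proj₁ (S-po p) _)

  R-irrefl : ∀ {x} → ¬ ⟦ R p ⟧ x x
  R-irrefl = Bool.not-¬ (proj₁ (R-po p) _)

  comparable : ∀ {x y} → x ≢ y → Comparable ⟦ S p ⟧ x y ⊎ Comparable ⟦ R p ⟧ x y
  comparable {x} {y} x≢y =
    Sum.map (to ∨≡true⇔) (to ∨≡true⇔) (proj₁ (xor≡true⇒ (exactlyOne p x y x≢y)))

  exclusive : ∀ {x y} → Comparable ⟦ S p ⟧ x y → Comparable ⟦ R p ⟧ x y → ⊥
  exclusive {x} {y} xSy xRy with x Fin.≟ y
  ... | yes refl = [ S-irrefl , S-irrefl ] xSy
  ... | no x≢y   = proj₂ (xor≡true⇒ (exactlyOne p x y x≢y)) (from ∨≡true⇔ xSy , from ∨≡true⇔ xRy)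

  compatible : ∀ {x y z} → ⟦ S p ⟧ x y → ⟦ R p ⟧ y z → ⟦ R p ⟧ x z
  compatible {x} {y} {z} xSy yRz = compat p x y z x≢y y≢z x≢z xSy yRz
    where
    x≢y : x ≢ y
    x≢y refl = S-irrefl xSy
    y≢z : y ≢ z
    y≢z refl = R-irrefl yRz
    x≢z : x ≢ z
    x≢z refl = exclusive (inj₁ xSy) (inj₂ yRz)

catalanPair : ∀ {n} {_≺_ _◁_ : Rel (Fin n) 0ℓ} → Decidable _≺_ → Decidable _◁_ →
              IsCatalanPair _≺_ _◁_ → CatalanPair n
catalanPair _≺?_ _◁?_ isCatalan = record
  { S          = λ x y → does (x ≺? y)
  ; R          = λ x y → does (x ◁? y)
  ; S-po       = does-isStrictPartialOrder _≺?_ ≺-isStrictPartialOrder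
  ; R-po       = does-isStrictPartialOrder _◁?_ ◁-isStrictPartialOrder
  ; exactlyOne = λ x y x≢y →
      does-xor ((x ≺? y) ⊎-dec (y ≺? x)) ((x ◁? y) ⊎-dec (y ◁? x)) (comparable x≢y) (uncurry exclusive)
  ; compat     = λ x y z _ _ _ x≺y y◁z →
      dec-true (x ◁? z) (compatible (to (does≡true⇔ (x ≺? y)) x≺y) (to (does≡true⇔ (y ◁? z)) y◁z))
  }
  where open IsCatalanPair isCatalan

T-maximal : ∀ {n} (r : Rel₂ n) x → T (all (λ y → not (r x y)) (allFin n)) ⇔ Maximal ⟦ r ⟧ x
T-maximal r x = mk⇔
  (λ max y → Bool.not-¬ (to Bool.T-not-≡ (tabulate⁻ (all⁺ _ _ max) y)))
  (λ max → all⁻ _ (tabulate⁺ λ y → from Bool.T-not-≡ (Bool.¬-not (max y))))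

maxCount-cong : ∀ {n} {r r′ : Rel₂ n} → (∀ x → Maximal ⟦ r ⟧ x ⇔ Maximal ⟦ r′ ⟧ x) →
                maxCount r ≡ maxCount r′
maxCount-cong {n} {r} {r′} max⇔max =
  cong length (filter-≐ _ _ ((λ {x} → to (same x)) , (λ {x} → from (same x))) (allFin n))
  where
  same : ∀ x → T (all (λ y → not (r x y)) (allFin n)) ⇔ T (all (λ y → not (r′ x y)) (allFin n))
  same x = ⇔.trans (T-maximal r x) (⇔.trans (max⇔max x) (⇔.sym (T-maximal r′ x)))

φ≺? : ∀ {n} (p : CatalanPair n) → Decidable (φ≺ ⟦ S p ⟧ ⟦ R p ⟧)
φ≺? p = φ≺-dec (⟦⟧-dec (S p)) (⟦⟧-dec (R p))

φ◁? : ∀ {n} (p : CatalanPair n) → Decidable (φ◁ ⟦ S p ⟧ ⟦ R p ⟧)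
φ◁? p = φ◁-dec (⟦⟧-dec (S p)) (⟦⟧-dec (R p))

φ : ∀ {n} → CatalanPair n → CatalanPair n
φ p = catalanPair (φ≺? p) (φ◁? p) (Involution.φ-isCatalanPair (⟦⟧-dec (S p)) (isCatalanPair p))

⟦S-φ⟧ : ∀ {n} (p : CatalanPair n) → ⟦ S (φ p) ⟧ ⇔[ id ] φ≺ ⟦ S p ⟧ ⟦ R p ⟧
⟦S-φ⟧ p = mk⇔[] λ x y → does≡true⇔ (φ≺? p x y)

⟦R-φ⟧ : ∀ {n} (p : CatalanPair n) → ⟦ R (φ p) ⟧ ⇔[ id ] φ◁ ⟦ S p ⟧ ⟦ R p ⟧
⟦R-φ⟧ p = mk⇔[] λ x y → does≡true⇔ (φ◁? p x y)

module _ {n} (p : CatalanPair n) where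

  open Involution (⟦⟧-dec (S p)) (isCatalanPair p)

  maxS-φ : maxS (φ p) ≡ maxR p
  maxS-φ = maxCount-cong λ x → ⇔.trans (Maximal-cong (⇔-at (⟦S-φ⟧ p)) x) (maximal-φ≺⇔ x)

  maxR-φ : maxR (φ p) ≡ maxS p
  maxR-φ = maxCount-cong λ x → ⇔.trans (Maximal-cong (⇔-at (⟦R-φ⟧ p)) x) (maximal-φ◁⇔ x)

  φ-involutive : φ (φ p) ≅ p
  φ-involutive = id , (λ x y → Bool.⇔→≡ (S-φφ x y)) , (λ x y → Bool.⇔→≡ (R-φφ x y))
    where
    S-φφ : ∀ x y → ⟦ S (φ (φ p)) ⟧ x y ⇔ ⟦ S p ⟧ x y
    S-φφ x y = ⇔.trans (⇔-at (⟦S-φ⟧ (φ p)) x y)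
                (⇔.trans (⇔-at (φ≺-resp (⟦S-φ⟧ p) (⟦R-φ⟧ p)) x y) (φ≺-involutive x y))

    R-φφ : ∀ x y → ⟦ R (φ (φ p)) ⟧ x y ⇔ ⟦ R p ⟧ x y
    R-φφ x y = ⇔.trans (⇔-at (⟦R-φ⟧ (φ p)) x y)
                (⇔.trans (⇔-at (φ◁-resp (⟦S-φ⟧ p) (⟦R-φ⟧ p)) x y) (φ◁-involutive x y))

φ-cong : ∀ {n} {p q : CatalanPair n} → p ≅ q → φ p ≅ φ q
φ-cong {p = p} {q} (σ , S≡ , R≡) =
    σ
  , (λ x y → does-⇔ (⇔-at (φ≺-resp S⇔ R⇔) x y) (φ≺? p x y) (φ≺? q _ _))
  , (λ x y → does-⇔ (⇔-at (φ◁-resp S⇔ R⇔) x y) (φ◁? p x y) (φ◁? q _ _))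
  where
  S⇔ : ⟦ S p ⟧ ⇔[ σ ] ⟦ S q ⟧
  S⇔ = ⟦⟧-resp S≡

  R⇔ : ⟦ R p ⟧ ⇔[ σ ] ⟦ R q ⟧
  R⇔ = ⟦⟧-resp R≡

swapStatistics : ∀ {n k l} → PairsWith n k l → PairsWith n l k
swapStatistics (p , maxS≡k , maxR≡l) = φ p , trans (maxS-φ p) maxR≡l , trans (maxR-φ p) maxS≡k

proposition2p13 : (n k l : ℕ) → SameNumberOfIsoTypes {n} {k} {l} {l} {k}
proposition2p13 n k l =
    swapStatistics
  , swapStatistics
  , (λ a b → φ-cong {p = proj₁ a} {proj₁ b})
  , (λ a b → φ-cong {p = proj₁ a} {proj₁ b})
  , (λ a → φ-involutive (proj₁ a))
  , (λ b → φ-involutive (proj₁ b))
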